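{- Let $\Sigma\in Sat(\mathsf{BQL}_{\mathsf{CD}})$, let $\Gamma$ be a finite set of $\mathcal{L}^+$-sentences and $\phi$ an $\mathcal{L}^+$-sentence. If $\Sigma\cup\Gamma\not\vdash_\Sigma\phi$ then there exists a set $\Theta\supseteq\Sigma\cup\Gamma$ such that $\Theta\in Sat(\mathsf{BQL}_{\mathsf{CD}}(\Sigma))$ and $\phi\notin\Theta$.
   Context: Standing assumption: $\mathcal{L}$ is a countable first-order language whose formulas are built from atomic formulas, $\top$ and $\bot$ using exactly $\wedge,\vee,\rightarrow,\forall,\exists$; $\mathcal{L}^+=\mathcal{L}\cup\{a_i\}_{i\in\omega}$ with the $a_i$ fresh constant symbols; $\phi(t)$ denotes substitution of $t$ for the free variable $v$. The natural deduction system $\mathcal{N}\mathsf{BQL}_{\mathsf{CD}}$ consists of trees of (possibly discharged) $\mathcal{L}^+$-sentences built with the following rules, where all displayed formulas are sentences (so e.g. in CD, $v$ is not free in $\phi$) and $t$ ranges over closed $\mathcal{L}^+$-terms: ($\top$-Int) $\top$ may be placed at a leaf as an already-discharged assumption; ($\bot$-Elim) from $\bot$ infer $\phi$; ($\wedge$-Int) from $\phi,\psi$ infer $\phi\wedge\psi$; ($\wedge$-Elim) from $\phi\wedge\psi$ infer $\phi$, or infer $\psi$; ($\vee$-Int) from $\phi$ or from $\psi$ infer $\phi\vee\psi$; ($\vee$-Elim) from $\phi\vee\psi$, a derivation of $\chi$ from assumption $\phi$ and a derivation of $\chi$ from assumption $\psi$, infer $\chi$, discharging those assumptions; ($\rightarrow$-Int)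 from a derivation of $\psi$ from assumption $\phi$ infer $\phi\rightarrow\psi$, discharging $\phi$; (Internal Transitivity) from $\phi\rightarrow\psi$ and $\psi\rightarrow\chi$ infer $\phi\rightarrow\chi$; (Internal $\wedge$-Int) from $\phi\rightarrow\psi$ and $\phi\rightarrow\chi$ infer $\phi\rightarrow\psi\wedge\chi$; (Internal $\vee$-Elim) from $\phi\rightarrow\chi$ and $\psi\rightarrow\chi$ infer $\phi\vee\psi\rightarrow\chi$; (Internal $\forall$-Int) from $\forall v(\phi\rightarrow\psi)$ infer $\phi\rightarrow\forall v\psi$; (Internal $\exists$-Elim) from $\forall v(\phi\rightarrow\psi)$ infer $\exists v\phi\rightarrow\psi$; ($\forall$-Int) from $\phi(a_i)$ infer $\forall v\phi$, provided $a_i$ occurs neither in $\phi$ nor in any open assumption of the derivation of $\phi(a_i)$; ($\forall$-Elim) from $\forall v\phi$ infer $\phi(t)$; (CD) from $\forall v(\phi\vee\psi)$ infer $\phi\vee\forall v\psi$; ($\exists$-Int) from $\phi(t)$ infer $\exists v\phi$; ($\exists$-Elim) from $\exists v\phi$ and a derivation of $\psi$ from assumption $\phi(a_i)$ infer $\psi$, discharging $\phi(a_i)$, provided $a_i$ occurs neither in $\phi$, nor in $\psi$, nor in any open assumption other than $\phi(a_i)$ of that derivation. There is no modus ponens rule. $\Gamma\vdash\phi$ means there is such a tree with root $\phi$ all of whose open assumptions lie in $\Gamma$. For a set $\Sigma$ of $\mathcal{L}^+$-sentences, $\mathcal{N}\mathsf{BQL}_{\mathsf{CD}}(\Sigma)$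 is obtained from $\mathcal{N}\mathsf{BQL}_{\mathsf{CD}}$ by adding the rule: from $\phi$ and $\phi\rightarrow\psi$ infer $\psi$, where the premise $\phi\rightarrow\psi$ must be the conclusion of a derivation in $\mathcal{N}\mathsf{BQL}_{\mathsf{CD}}$ from assumptions in $\Sigma$. An occurrence of an open assumption lying in such a derivation of the premise $\phi\rightarrow\psi$ of an application of this new rule is called unsafe. Restrictions: (i) no unsafe occurrence of an assumption can be discharged; (ii) in $\exists$-Elim, no occurrence of the assumption $\phi(a_i)$ in the derivation of the minor premise may be unsafe. $\Delta\vdash_\Sigma\phi$ means there is a proof of $\phi$ in $\mathcal{N}\mathsf{BQL}_{\mathsf{CD}}(\Sigma)$ all of whose open assumptions lie in $\Delta$. A set $\Theta$ of $\mathcal{L}^+$-sentences is a prime saturated $\mathsf{BQL}_{\mathsf{CD}}$-theory iff: $\bot\notin\Theta$; if $\Theta\vdash\phi$ then $\phi\in\Theta$; if $\phi\vee\psi\in\Theta$ then $\phi\in\Theta$ or $\psi\in\Theta$; if $\exists v\phi\in\Theta$ then $\phi(t)\in\Theta$ for some closed $\mathcal{L}^+$-term $t$; if $\phi(t)\in\Theta$ for every closed $\mathcal{L}^+$-term $t$ then $\forall v\phi\in\Theta$. $Sat(\mathsf{BQL}_{\mathsf{CD}})$ is the set of these. $Sat(\mathsf{BQL}_{\mathsf{CD}}(\Sigma))$ is defined in exactly the same way but with $\vdash_\Sigma$ in place of $\vdash$ in the closure condition (if $\Theta\vdash_\Sigma\phi$ then $\phi\in\Theta$). -}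

module Defs where

open import Level using (0ℓ)
open import Data.Nat using (ℕ; zero; suc)
open import Data.Fin using (Fin; zero; suc)
open import Data.Vec using (Vec; []; _∷_)
import Data.Vec.Relation.Unary.Any as VAny
open import Data.List using (List; []; _∷_; _++_; map)
open import Data.List.Relation.Unary.All using (All)
import Data.List.Membership.Propositional as LMem
open import Data.Product using (Σ-syntax; _×_; _,_; proj₁)
open import Data.Sum using (_⊎_)
open import Data.Empty using (⊥)
open import Relation.Nullary using (¬_)
open import Relation.Binary.PropositionalEquality using (_≡_; _≢_)
open import Function.Bundles using (_↣_)

-- A countable first-order signature (no built-in equality; constants are
-- 0-ary function symbols).  Countability: injections into ℕ.
record Signature : Set₁ where
  field
    Func         : Set
    Rel          : Set
    funArity     : Func → ℕ
    relArity     : Rel → ℕ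
    funCountable : Func ↣ ℕ
    relCountable : Rel ↣ ℕ

module Logic (L : Signature) where
  open Signature L

  -- Terms of L⁺ with n free (de Bruijn) variables; par i is the fresh constant a_i.
  data Term (n : ℕ) : Set where
    var : Fin n → Term n
    par : ℕ → Term n
    fun : (f : Func) → Vec (Term n) (funArity f) → Term n

  infixr 7 _∧ᶠ_
  infixr 6 _∨ᶠ_
  infixr 5 _⇒_

  data Formula (n : ℕ) : Set where
    atom : (r : Rel) → Vec (Term n) (relArity r) → Formula n
    ⊤ᶠ ⊥ᶠ : Formula n
    _∧ᶠ_ _∨ᶠ_ _⇒_ : Formula n → Formula n → Formula n
    ∀ᶠ ∃ᶠ : Formula (suc n) → Formula n

  Sentence : Set
  Sentence = Formula 0

  ClosedTerm : Set
  ClosedTerm = Term 0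

  mutual
    substT : ∀ {n m} → (Fin n → Term m) → Term n → Term m
    substT σ (var x) = σ x
    substT σ (par i) = par i
    substT σ (fun f ts) = fun f (substTs σ ts)

    substTs : ∀ {n m k} → (Fin n → Term m) → Vec (Term n) k → Vec (Term m) k
    substTs σ [] = []
    substTs σ (t ∷ ts) = substT σ t ∷ substTs σ ts

  lift : ∀ {n m} → (Fin n → Term m) → Fin (suc n) → Term (suc m)
  lift σ zero = var zero
  lift σ (suc x) = substT (λ y → var (suc y)) (σ x)

  substF : ∀ {n m} → (Fin n → Term m) → Formula n → Formula m
  substF σ (atom r ts) = atom r (substTs σ ts)
  substF σ ⊤ᶠ = ⊤ᶠ
  substF σ ⊥ᶠ = ⊥ᶠ
  substF σ (φ ∧ᶠ ψ) = substF σ φ ∧ᶠ substF σ ψ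
  substF σ (φ ∨ᶠ ψ) = substF σ φ ∨ᶠ substF σ ψ
  substF σ (φ ⇒ ψ) = substF σ φ ⇒ substF σ ψ
  substF σ (∀ᶠ φ) = ∀ᶠ (substF (lift σ) φ)
  substF σ (∃ᶠ φ) = ∃ᶠ (substF (lift σ) φ)

  _[_] : Formula 1 → ClosedTerm → Sentence
  φ [ t ] = substF (λ _ → t) φ

  -- A sentence regarded as a formula in which the bound variable v is not free.
  wk : Sentence → Formula 1
  wk = substF (λ ())

  data _occT_ (i : ℕ) {n : ℕ} : Term n → Set where
    here  : i occT par i
    inArg : ∀ {f ts} → VAny.Any (i occT_) ts → i occT fun f ts

  data _occF_ (i : ℕ) : ∀ {n} → Formula n → Set where
    atom : ∀ {n r ts} → VAny.Any (i occT_) ts → i occF atom {n} r ts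
    ∧ˡ : ∀ {n} {φ ψ : Formula n} → i occF φ → i occF (φ ∧ᶠ ψ)
    ∧ʳ : ∀ {n} {φ ψ : Formula n} → i occF ψ → i occF (φ ∧ᶠ ψ)
    ∨ˡ : ∀ {n} {φ ψ : Formula n} → i occF φ → i occF (φ ∨ᶠ ψ)
    ∨ʳ : ∀ {n} {φ ψ : Formula n} → i occF ψ → i occF (φ ∨ᶠ ψ)
    ⇒ˡ : ∀ {n} {φ ψ : Formula n} → i occF φ → i occF (φ ⇒ ψ)
    ⇒ʳ : ∀ {n} {φ ψ : Formula n} → i occF ψ → i occF (φ ⇒ ψ)
    ∀ᵒ : ∀ {n} {φ : Formula (suc n)} → i occF φ → i occF (∀ᶠ φ)
    ∃ᵒ : ∀ {n} {φ : Formula (suc n)} → i occF φ → i occF (∃ᶠ φ)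

  data Safety : Set where
    safe unsafe : Safety

  Occ : Set
  Occ = Sentence × Safety

  markRisky : Occ → Occ
  markRisky (φ , _) = (φ , unsafe)

  Fresh : ℕ → List Occ → Set
  Fresh i O = All (λ o → ¬ (i occF proj₁ o)) O

  -- Discharging some (possibly none) occurrences of φ; only SAFE occurrences
  -- may be discharged (restriction (i)).
  data Discharge (φ : Sentence) : List Occ → List Occ → Set where
    []   : Discharge φ [] []
    keep : ∀ {o O O'} → Discharge φ O O' → Discharge φ (o ∷ O) (o ∷ O')
    drop : ∀ {O O'} → Discharge φ O O' → Discharge φ ((φ , safe) ∷ O) O'

  -- Discharging ALL occurrences of φ, each of which must be safe
  -- (used for ∃-Elim; restriction (ii)).
  data DischargeAll (φ : Sentence) : List Occ → List Occ → Set where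
    []   : DischargeAll φ [] []
    keep : ∀ {ψ s O O'} → ψ ≢ φ → DischargeAll φ O O' →
           DischargeAll φ ((ψ , s) ∷ O) ((ψ , s) ∷ O')
    drop : ∀ {O O'} → DischargeAll φ O O' → DischargeAll φ ((φ , safe) ∷ O) O'

  -- basic = NBQL_CD ; extended = NBQL_CD(Σ)
  data System : Set where
    basic extended : System

  -- Der S sys O φ : a derivation tree in system sys with root φ whose open
  -- assumption occurrences are exactly the list O.  The parameter S is the
  -- set Σ used by the extra rule (irrelevant for sys = basic).
  data Der (S : Sentence → Set) : System → List Occ → Sentence → Set where
    hyp  : ∀ {s φ} → Der S s ((φ , safe) ∷ []) φ
    ⊤I   : ∀ {s} → Der S s [] ⊤ᶠ
    ⊥E   : ∀ {s O φ} → Der S s O ⊥ᶠ → Der S s O φ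
    ∧I   : ∀ {s O₁ O₂ φ ψ} → Der S s O₁ φ → Der S s O₂ ψ → Der S s (O₁ ++ O₂) (φ ∧ᶠ ψ)
    ∧E₁  : ∀ {s O φ ψ} → Der S s O (φ ∧ᶠ ψ) → Der S s O φ
    ∧E₂  : ∀ {s O φ ψ} → Der S s O (φ ∧ᶠ ψ) → Der S s O ψ
    ∨I₁  : ∀ {s O φ ψ} → Der S s O φ → Der S s O (φ ∨ᶠ ψ)
    ∨I₂  : ∀ {s O φ ψ} → Der S s O ψ → Der S s O (φ ∨ᶠ ψ)
    ∨E   : ∀ {s O O₁ O₁' O₂ O₂' φ ψ χ} →
           Der S s O (φ ∨ᶠ ψ) →
           Der S s O₁ χ → Discharge φ O₁ O₁' →
           Der S s O₂ χ → Discharge ψ O₂ O₂' →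
           Der S s (O ++ O₁' ++ O₂') χ
    ⇒I   : ∀ {s O O' φ ψ} → Der S s O ψ → Discharge φ O O' → Der S s O' (φ ⇒ ψ)
    iTrans : ∀ {s O₁ O₂ φ ψ χ} → Der S s O₁ (φ ⇒ ψ) → Der S s O₂ (ψ ⇒ χ) →
             Der S s (O₁ ++ O₂) (φ ⇒ χ)
    i∧I  : ∀ {s O₁ O₂ φ ψ χ} → Der S s O₁ (φ ⇒ ψ) → Der S s O₂ (φ ⇒ χ) →
           Der S s (O₁ ++ O₂) (φ ⇒ ψ ∧ᶠ χ)
    i∨E  : ∀ {s O₁ O₂ φ ψ χ} → Der S s O₁ (φ ⇒ χ) → Der S s O₂ (ψ ⇒ χ) →
           Der S s (O₁ ++ O₂) (φ ∨ᶠ ψ ⇒ χ)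
    i∀I  : ∀ {s O} {φ : Sentence} {ψ : Formula 1} →
           Der S s O (∀ᶠ (wk φ ⇒ ψ)) → Der S s O (φ ⇒ ∀ᶠ ψ)
    i∃E  : ∀ {s O} {φ : Formula 1} {ψ : Sentence} →
           Der S s O (∀ᶠ (φ ⇒ wk ψ)) → Der S s O (∃ᶠ φ ⇒ ψ)
    ∀I   : ∀ {s O i} {φ : Formula 1} →
           Der S s O (φ [ par i ]) → ¬ (i occF φ) → Fresh i O → Der S s O (∀ᶠ φ)
    ∀E   : ∀ {s O} {φ : Formula 1} (t : ClosedTerm) → Der S s O (∀ᶠ φ) → Der S s O (φ [ t ])
    CD   : ∀ {s O} {φ : Sentence} {ψ : Formula 1} →
           Der S s O (∀ᶠ (wk φ ∨ᶠ ψ)) → Der S s O (φ ∨ᶠ ∀ᶠ ψ)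
    ∃I   : ∀ {s O} {φ : Formula 1} (t : ClosedTerm) → Der S s O (φ [ t ]) → Der S s O (∃ᶠ φ)
    ∃E   : ∀ {s O O₁ O₁' i} {φ : Formula 1} {ψ : Sentence} →
           Der S s O (∃ᶠ φ) →
           Der S s O₁ ψ → DischargeAll (φ [ par i ]) O₁ O₁' →
           ¬ (i occF φ) → ¬ (i occF ψ) → Fresh i O₁' →
           Der S s (O ++ O₁') ψ
    mp   : ∀ {O O' φ ψ} → Der S extended O φ → Der S basic O' (φ ⇒ ψ) →
           All (λ o → S (proj₁ o)) O' →
           Der S extended (O ++ map markRisky O') ψ

  _⊢_ : (Sentence → Set) → Sentence → Set
  Γ ⊢ φ = Σ[ O ∈ List Occ ] (Der (λ _ → ⊥) basic O φ × All (λ o → Γ (proj₁ o)) O)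

  _⊢[_]_ : (Sentence → Set) → (Sentence → Set) → Sentence → Set
  Δ ⊢[ S ] φ = Σ[ O ∈ List Occ ] (Der S extended O φ × All (λ o → Δ (proj₁ o)) O)

  record IsPrimeSat (_⊩_ : (Sentence → Set) → Sentence → Set) (Θ : Sentence → Set) : Set₁ where
    field
      consistent : ¬ Θ ⊥ᶠ
      closed     : ∀ φ → Θ ⊩ φ → Θ φ
      prime      : ∀ φ ψ → Θ (φ ∨ᶠ ψ) → Θ φ ⊎ Θ ψ
      witness    : ∀ (φ : Formula 1) → Θ (∃ᶠ φ) → Σ[ t ∈ ClosedTerm ] Θ (φ [ t ])
      omega      : ∀ (φ : Formula 1) → (∀ (t : ClosedTerm) → Θ (φ [ t ])) → Θ (∀ᶠ φ)

  Sat : (Sentence → Set) → Set₁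
  Sat = IsPrimeSat _⊢_

  SatΣ : (Sentence → Set) → (Sentence → Set) → Set₁
  SatΣ S = IsPrimeSat (_⊢[ S ]_)

  _∪ˡ_ : (Sentence → Set) → List Sentence → Sentence → Set
  (S ∪ˡ Γ) ψ = S ψ ⊎ LMem._∈_ ψ Γ

module Submission where

-- Enumerate all L⁺-sentences ψ₀, ψ₁, … and build finite lists F (accepted)
-- and R (rejected), maintaining the invariant  Σ ∌ ⋀F → (⋁R ∨ φ),  starting
-- from F = Γ.  Step n accepts ψₙ if that keeps the invariant and rejects it
-- otherwise (by distribution one of the two does).  An accepted ∃vα, or a
-- rejected ∀vα, is accompanied by an instance α(t): one exists because Σ obeys
-- the ω-rule (and, for ∀, the rule CD).  Then Θ = Σ ∪ ⋃F is the theory sought.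
-- Its closure under ⊢_Σ rests on a reduction lemma: a derivation in
-- NBQL_CD(Σ) of χ yields a derivation in NBQL_CD, from Σ, of ⋀(its safe
-- assumptions) → χ, so whatever Θ proves is implied over Σ by a finite stage.

open import Defs
open import Level using (0ℓ)
open import Axiom.ExcludedMiddle using (ExcludedMiddle)
open import Axiom.DoubleNegationElimination using (em⇒dne)
open import Data.Nat using (ℕ; zero; suc; _≤_; _<?_; _⊔_)
open import Data.Nat.Base using (_≤′_; ≤′-refl; ≤′-step)
open import Data.Nat.Properties using (≤-refl; ≤-trans; m≤m⊔n; m≤n⊔m; n≮n; ≤⇒≤′)
import Data.Nat.Binary as ℕᵇ
open import Data.Nat.Binary using (ℕᵇ; 2[1+_]; 1+[2_])
import Data.Nat.Binary.Properties as ℕᵇₚ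
open import Data.Fin using (Fin; zero; suc; toℕ; fromℕ<)
open import Data.Fin.Properties using (toℕ<n; fromℕ<-toℕ)
open import Data.Vec using (Vec; []; _∷_; replicate)
import Data.Vec.Relation.Unary.Any as VAny
open import Data.List using (List; []; _∷_; _++_; map)
open import Data.List.Properties using (++-identityʳ)
open import Data.List.Membership.Propositional using (_∈_)
open import Data.List.Membership.Propositional.Properties using (∈-++⁺ˡ; ∈-++⁺ʳ; ∈-map⁺)
open import Data.List.Relation.Unary.Any using (here; there)
open import Data.List.Relation.Unary.All as All using (All; []; _∷_)
open import Data.List.Relation.Unary.All.Properties using (++⁺; map⁺)
open import Data.Maybe using (Maybe; just; nothing; fromMaybe)
open import Data.Product using (Σ-syntax; _×_; _,_; proj₁; proj₂)
open import Data.Sum using (_⊎_; inj₁; inj₂)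
import Data.Sum as Sum
open import Data.Empty using (⊥; ⊥-elim)
open import Relation.Nullary using (¬_; Dec; yes; no)
open import Relation.Binary.PropositionalEquality hiding ([_])
open import Function.Bundles using (Injection; _↣_; mk↣)
open import Function.Construct.Composition using (_↣-∘_)

module Substitution (L : Signature) where
  open Logic L

  mutual
    substT-cong : ∀ {n m} {σ τ : Fin n → Term m} → (∀ x → σ x ≡ τ x) →
                  (t : Term n) → substT σ t ≡ substT τ t
    substT-cong h (var x) = h x
    substT-cong h (par i) = refl
    substT-cong h (fun f ts) = cong (fun f) (substTs-cong h ts)

    substTs-cong : ∀ {n m k} {σ τ : Fin n → Term m} → (∀ x → σ x ≡ τ x) →
                   (ts : Vec (Term n) k) → substTs σ ts ≡ substTs τ ts
    substTs-cong h [] = refl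
    substTs-cong h (t ∷ ts) = cong₂ _∷_ (substT-cong h t) (substTs-cong h ts)

  mutual
    substT-∘ : ∀ {n m k} (σ : Fin m → Term k) (τ : Fin n → Term m) (t : Term n) →
               substT σ (substT τ t) ≡ substT (λ x → substT σ (τ x)) t
    substT-∘ σ τ (var x) = refl
    substT-∘ σ τ (par i) = refl
    substT-∘ σ τ (fun f ts) = cong (fun f) (substTs-∘ σ τ ts)

    substTs-∘ : ∀ {n m k j} (σ : Fin m → Term k) (τ : Fin n → Term m) (ts : Vec (Term n) j) →
                substTs σ (substTs τ ts) ≡ substTs (λ x → substT σ (τ x)) ts
    substTs-∘ σ τ [] = refl
    substTs-∘ σ τ (t ∷ ts) = cong₂ _∷_ (substT-∘ σ τ t) (substTs-∘ σ τ ts)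

  mutual
    substT-id : ∀ {n} {σ : Fin n → Term n} → (∀ x → σ x ≡ var x) → (t : Term n) → substT σ t ≡ t
    substT-id h (var x) = h x
    substT-id h (par i) = refl
    substT-id h (fun f ts) = cong (fun f) (substTs-id h ts)

    substTs-id : ∀ {n k} {σ : Fin n → Term n} → (∀ x → σ x ≡ var x) →
                 (ts : Vec (Term n) k) → substTs σ ts ≡ ts
    substTs-id h [] = refl
    substTs-id h (t ∷ ts) = cong₂ _∷_ (substT-id h t) (substTs-id h ts)

  shift : ∀ {n} → Fin n → Term (suc n)
  shift x = var (suc x)

  lift-∘ : ∀ {n m k} (σ : Fin m → Term k) (τ : Fin n → Term m) (ρ : Fin n → Term k) →
           (∀ x → substT σ (τ x) ≡ ρ x) → ∀ x → substT (lift σ) (lift τ x) ≡ lift ρ x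
  lift-∘ σ τ ρ h zero = refl
  lift-∘ σ τ ρ h (suc x) = begin
    substT (lift σ) (substT shift (τ x))  ≡⟨ substT-∘ (lift σ) shift (τ x) ⟩
    substT (λ y → substT shift (σ y)) (τ x)  ≡⟨ substT-∘ shift σ (τ x) ⟨
    substT shift (substT σ (τ x))         ≡⟨ cong (substT shift) (h x) ⟩
    substT shift (ρ x)                    ∎
    where open ≡-Reasoning

  substF-∘ : ∀ {n m k} (σ : Fin m → Term k) (τ : Fin n → Term m) (ρ : Fin n → Term k) →
             (∀ x → substT σ (τ x) ≡ ρ x) → (φ : Formula n) → substF σ (substF τ φ) ≡ substF ρ φ
  substF-∘ σ τ ρ h (atom r ts) = cong (atom r) (trans (substTs-∘ σ τ ts) (substTs-cong h ts))
  substF-∘ σ τ ρ h ⊤ᶠ = refl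
  substF-∘ σ τ ρ h ⊥ᶠ = refl
  substF-∘ σ τ ρ h (φ ∧ᶠ ψ) = cong₂ _∧ᶠ_ (substF-∘ σ τ ρ h φ) (substF-∘ σ τ ρ h ψ)
  substF-∘ σ τ ρ h (φ ∨ᶠ ψ) = cong₂ _∨ᶠ_ (substF-∘ σ τ ρ h φ) (substF-∘ σ τ ρ h ψ)
  substF-∘ σ τ ρ h (φ ⇒ ψ) = cong₂ _⇒_ (substF-∘ σ τ ρ h φ) (substF-∘ σ τ ρ h ψ)
  substF-∘ σ τ ρ h (∀ᶠ φ) = cong ∀ᶠ (substF-∘ (lift σ) (lift τ) (lift ρ) (lift-∘ σ τ ρ h) φ)
  substF-∘ σ τ ρ h (∃ᶠ φ) = cong ∃ᶠ (substF-∘ (lift σ) (lift τ) (lift ρ) (lift-∘ σ τ ρ h) φ)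

  lift-id : ∀ {n} (σ : Fin n → Term n) → (∀ x → σ x ≡ var x) → ∀ x → lift σ x ≡ var x
  lift-id σ h zero = refl
  lift-id σ h (suc x) = cong (substT shift) (h x)

  substF-id : ∀ {n} (σ : Fin n → Term n) → (∀ x → σ x ≡ var x) → (φ : Formula n) → substF σ φ ≡ φ
  substF-id σ h (atom r ts) = cong (atom r) (substTs-id h ts)
  substF-id σ h ⊤ᶠ = refl
  substF-id σ h ⊥ᶠ = refl
  substF-id σ h (φ ∧ᶠ ψ) = cong₂ _∧ᶠ_ (substF-id σ h φ) (substF-id σ h ψ)
  substF-id σ h (φ ∨ᶠ ψ) = cong₂ _∨ᶠ_ (substF-id σ h φ) (substF-id σ h ψ)
  substF-id σ h (φ ⇒ ψ) = cong₂ _⇒_ (substF-id σ h φ) (substF-id σ h ψ)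
  substF-id σ h (∀ᶠ φ) = cong ∀ᶠ (substF-id (lift σ) (lift-id σ h) φ)
  substF-id σ h (∃ᶠ φ) = cong ∃ᶠ (substF-id (lift σ) (lift-id σ h) φ)

  wk-inst : (φ : Sentence) (t : ClosedTerm) → wk φ [ t ] ≡ φ
  wk-inst φ t = trans (substF-∘ (λ _ → t) (λ ()) (λ ()) (λ ()) φ) (substF-id (λ ()) (λ ()) φ)

  mutual
    occ-substT : ∀ {i n m} (σ : Fin n → Term m) (t : Term n) → i occT substT σ t →
                 i occT t ⊎ Σ[ x ∈ Fin n ] i occT σ x
    occ-substT σ (var x) o = inj₂ (x , o)
    occ-substT σ (par i) here = inj₁ here
    occ-substT σ (fun f ts) (inArg a) with occ-substTs σ ts a
    ... | inj₁ b = inj₁ (inArg b)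
    ... | inj₂ c = inj₂ c

    occ-substTs : ∀ {i n m k} (σ : Fin n → Term m) (ts : Vec (Term n) k) →
                  VAny.Any (i occT_) (substTs σ ts) → VAny.Any (i occT_) ts ⊎ Σ[ x ∈ Fin n ] i occT σ x
    occ-substTs σ (t ∷ ts) (VAny.here o) with occ-substT σ t o
    ... | inj₁ b = inj₁ (VAny.here b)
    ... | inj₂ c = inj₂ c
    occ-substTs σ (t ∷ ts) (VAny.there a) with occ-substTs σ ts a
    ... | inj₁ b = inj₁ (VAny.there b)
    ... | inj₂ c = inj₂ c

  occ-lift : ∀ {i n m} (σ : Fin n → Term m) (x : Fin (suc n)) → i occT lift σ x →
             Σ[ y ∈ Fin n ] i occT σ y
  occ-lift σ zero ()
  occ-lift σ (suc y) o with occ-substT shift (σ y) o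
  ... | inj₁ b = y , b
  ... | inj₂ (_ , ())

  occ-substF : ∀ {i n m} (σ : Fin n → Term m) (φ : Formula n) → i occF substF σ φ →
               i occF φ ⊎ Σ[ x ∈ Fin n ] i occT σ x
  occ-substF σ (atom r ts) (atom a) = Sum.map₁ atom (occ-substTs σ ts a)
  occ-substF σ (φ ∧ᶠ ψ) (∧ˡ o) = Sum.map₁ ∧ˡ (occ-substF σ φ o)
  occ-substF σ (φ ∧ᶠ ψ) (∧ʳ o) = Sum.map₁ ∧ʳ (occ-substF σ ψ o)
  occ-substF σ (φ ∨ᶠ ψ) (∨ˡ o) = Sum.map₁ ∨ˡ (occ-substF σ φ o)
  occ-substF σ (φ ∨ᶠ ψ) (∨ʳ o) = Sum.map₁ ∨ʳ (occ-substF σ ψ o)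
  occ-substF σ (φ ⇒ ψ) (⇒ˡ o) = Sum.map₁ ⇒ˡ (occ-substF σ φ o)
  occ-substF σ (φ ⇒ ψ) (⇒ʳ o) = Sum.map₁ ⇒ʳ (occ-substF σ ψ o)
  occ-substF σ (∀ᶠ φ) (∀ᵒ o) = Sum.map ∀ᵒ (λ (x , c) → occ-lift σ x c) (occ-substF (lift σ) φ o)
  occ-substF σ (∃ᶠ φ) (∃ᵒ o) = Sum.map ∃ᵒ (λ (x , c) → occ-lift σ x c) (occ-substF (lift σ) φ o)

  occ-wk : ∀ {i} (φ : Sentence) → i occF wk φ → i occF φ
  occ-wk φ o with occ-substF (λ ()) φ o
  ... | inj₁ b = b
  ... | inj₂ (() , _)

  -- Every formula misses some parameter: one above the largest occurring index.
  mutual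
    maxT : ∀ {n} → Term n → ℕ
    maxT (var x) = 0
    maxT (par i) = i
    maxT (fun f ts) = maxTs ts

    maxTs : ∀ {n k} → Vec (Term n) k → ℕ
    maxTs [] = 0
    maxTs (t ∷ ts) = maxT t ⊔ maxTs ts

  maxF : ∀ {n} → Formula n → ℕ
  maxF (atom r ts) = maxTs ts
  maxF ⊤ᶠ = 0
  maxF ⊥ᶠ = 0
  maxF (φ ∧ᶠ ψ) = maxF φ ⊔ maxF ψ
  maxF (φ ∨ᶠ ψ) = maxF φ ⊔ maxF ψ
  maxF (φ ⇒ ψ) = maxF φ ⊔ maxF ψ
  maxF (∀ᶠ φ) = maxF φ
  maxF (∃ᶠ φ) = maxF φ

  mutual
    occT≤ : ∀ {i n} (t : Term n) → i occT t → i ≤ maxT t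
    occT≤ (par i) here = ≤-refl
    occT≤ (fun f ts) (inArg a) = occTs≤ ts a

    occTs≤ : ∀ {i n k} (ts : Vec (Term n) k) → VAny.Any (i occT_) ts → i ≤ maxTs ts
    occTs≤ (t ∷ ts) (VAny.here o) = ≤-trans (occT≤ t o) (m≤m⊔n _ _)
    occTs≤ (t ∷ ts) (VAny.there a) = ≤-trans (occTs≤ ts a) (m≤n⊔m _ _)

  occF≤ : ∀ {i n} (φ : Formula n) → i occF φ → i ≤ maxF φ
  occF≤ (atom r ts) (atom a) = occTs≤ ts a
  occF≤ (φ ∧ᶠ ψ) (∧ˡ o) = ≤-trans (occF≤ φ o) (m≤m⊔n _ _)
  occF≤ (φ ∧ᶠ ψ) (∧ʳ o) = ≤-trans (occF≤ ψ o) (m≤n⊔m _ _)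
  occF≤ (φ ∨ᶠ ψ) (∨ˡ o) = ≤-trans (occF≤ φ o) (m≤m⊔n _ _)
  occF≤ (φ ∨ᶠ ψ) (∨ʳ o) = ≤-trans (occF≤ ψ o) (m≤n⊔m _ _)
  occF≤ (φ ⇒ ψ) (⇒ˡ o) = ≤-trans (occF≤ φ o) (m≤m⊔n _ _)
  occF≤ (φ ⇒ ψ) (⇒ʳ o) = ≤-trans (occF≤ ψ o) (m≤n⊔m _ _)
  occF≤ (∀ᶠ φ) (∀ᵒ o) = occF≤ φ o
  occF≤ (∃ᶠ φ) (∃ᵒ o) = occF≤ φ o

  freshPar : ∀ {n} → Formula n → ℕ
  freshPar φ = suc (maxF φ)

  freshPar-fresh : ∀ {n} (φ : Formula n) → ¬ (freshPar φ occF φ)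
  freshPar-fresh φ o = n≮n _ (occF≤ φ o)

-- Under excluded middle an injection into ℕ has a partial inverse; this is
-- how a countable type is enumerated.
module _ (em : ExcludedMiddle 0ℓ) {A : Set} (ι : A ↣ ℕ) where
  open Injection ι using (to; injective)

  uncode : ℕ → Maybe A
  uncode k with em {Σ[ a ∈ A ] to a ≡ k}
  ... | yes (a , _) = just a
  ... | no _ = nothing

  uncode-to : ∀ a → uncode (to a) ≡ just a
  uncode-to a with em {Σ[ b ∈ A ] to b ≡ to a}
  ... | yes (b , e) = cong just (injective e)
  ... | no ∄b = ⊥-elim (∄b (a , refl))

-- Finitely branching ℕ-labelled trees: a universal syntax for codes.
data Code : Set where
  node : ℕ → List Code → Code

leaf : ℕ → Code
leaf k = node k []

-- Trees are written as binary numerals: a label k becomes k one-digits and a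
-- zero-digit; each child is announced by a one-digit and the list is closed
-- by a zero-digit.
unary : ℕ → ℕᵇ → ℕᵇ
unary zero b = 1+[2 b ]
unary (suc k) b = 2[1+ unary k b ]

mutual
  codeBits : Code → ℕᵇ → ℕᵇ
  codeBits (node k cs) b = unary k (childBits cs b)

  childBits : List Code → ℕᵇ → ℕᵇ
  childBits [] b = 1+[2 b ]
  childBits (c ∷ cs) b = 2[1+ codeBits c (childBits cs b) ]

2[1+]-injective : ∀ {x y} → 2[1+ x ] ≡ 2[1+ y ] → x ≡ y
2[1+]-injective refl = refl

unary-injective : ∀ k l {b d} → unary k b ≡ unary l d → k ≡ l × b ≡ d
unary-injective zero zero refl = refl , refl
unary-injective (suc k) (suc l) e with unary-injective k l (2[1+]-injective e)
... | refl , e′ = refl , e′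

mutual
  codeBits-injective : ∀ c c′ {b d} → codeBits c b ≡ codeBits c′ d → c ≡ c′ × b ≡ d
  codeBits-injective (node k cs) (node l cs′) e with unary-injective k l e
  ... | refl , e′ with childBits-injective cs cs′ e′
  ... | refl , e″ = refl , e″

  childBits-injective : ∀ cs cs′ {b d} → childBits cs b ≡ childBits cs′ d → cs ≡ cs′ × b ≡ d
  childBits-injective [] [] refl = refl , refl
  childBits-injective (c ∷ cs) (c′ ∷ cs′) e with codeBits-injective c c′ (2[1+]-injective e)
  ... | refl , e′ with childBits-injective cs cs′ e′
  ... | refl , e″ = refl , e″

Code↣ℕ : Code ↣ ℕ
Code↣ℕ = mk↣ {to = λ c → ℕᵇ.toℕ (codeBits c ℕᵇ.zero)}
               (λ e → proj₁ (codeBits-injective _ _ (ℕᵇₚ.toℕ-injective e)))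

-- Formulas are coded as trees; decoding (total, with junk values) is a left
-- inverse of coding, so sentences inject into ℕ and can be enumerated.
module Enumeration (em : ExcludedMiddle 0ℓ) (L : Signature) where
  open Signature L
  open Logic L

  mutual
    encT : ∀ {n} → Term n → Code
    encT (var x) = node 0 (leaf (toℕ x) ∷ [])
    encT (par i) = node 1 (leaf i ∷ [])
    encT (fun f ts) = node 2 (leaf (Injection.to funCountable f) ∷ encTs ts)

    encTs : ∀ {n k} → Vec (Term n) k → List Code
    encTs [] = []
    encTs (t ∷ ts) = encT t ∷ encTs ts

  encF : ∀ {n} → Formula n → Code
  encF (atom r ts) = node 0 (leaf (Injection.to relCountable r) ∷ encTs ts)
  encF ⊤ᶠ = node 1 []
  encF ⊥ᶠ = node 2 []
  encF (φ ∧ᶠ ψ) = node 3 (encF φ ∷ encF ψ ∷ [])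
  encF (φ ∨ᶠ ψ) = node 4 (encF φ ∷ encF ψ ∷ [])
  encF (φ ⇒ ψ) = node 5 (encF φ ∷ encF ψ ∷ [])
  encF (∀ᶠ φ) = node 6 (encF φ ∷ [])
  encF (∃ᶠ φ) = node 7 (encF φ ∷ [])

  -- Decoding returns a junk value on ill-formed trees.
  junk : ∀ {n} → Term n
  junk = par 0

  decVar : ∀ {n} → ℕ → Term n
  decVar {n} k with k <? n
  ... | yes k<n = var (fromℕ< k<n)
  ... | no _ = junk

  decVar-toℕ : ∀ {n} (x : Fin n) → decVar (toℕ x) ≡ var x
  decVar-toℕ {n} x with toℕ x <? n
  ... | yes x<n = cong var (fromℕ<-toℕ x x<n)
  ... | no x≮n = ⊥-elim (x≮n (toℕ<n x))

  mutual
    decT : ∀ {n} → Code → Term n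
    decT (node 0 (node k [] ∷ [])) = decVar k
    decT (node 1 (node i [] ∷ [])) = par i
    decT (node 2 (node k [] ∷ cs)) with uncode em funCountable k
    ... | just f = fun f (decTs cs)
    ... | nothing = junk
    decT _ = junk

    decTs : ∀ {n k} → List Code → Vec (Term n) k
    decTs {k = zero} _ = []
    decTs {k = suc k} [] = replicate (suc k) junk
    decTs {k = suc k} (c ∷ cs) = decT c ∷ decTs cs

  decF : ∀ {n} → Code → Formula n
  decF (node 0 (node k [] ∷ cs)) with uncode em relCountable k
  ... | just r = atom r (decTs cs)
  ... | nothing = ⊤ᶠ
  decF (node 1 []) = ⊤ᶠ
  decF (node 2 []) = ⊥ᶠ
  decF (node 3 (c ∷ d ∷ [])) = decF c ∧ᶠ decF d
  decF (node 4 (c ∷ d ∷ [])) = decF c ∨ᶠ decF d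
  decF (node 5 (c ∷ d ∷ [])) = decF c ⇒ decF d
  decF (node 6 (c ∷ [])) = ∀ᶠ (decF c)
  decF (node 7 (c ∷ [])) = ∃ᶠ (decF c)
  decF _ = ⊤ᶠ

  mutual
    decT-encT : ∀ {n} (t : Term n) → decT (encT t) ≡ t
    decT-encT (var x) = decVar-toℕ x
    decT-encT (par i) = refl
    decT-encT (fun f ts) rewrite uncode-to em funCountable f = cong (fun f) (decTs-encTs ts)

    decTs-encTs : ∀ {n k} (ts : Vec (Term n) k) → decTs (encTs ts) ≡ ts
    decTs-encTs [] = refl
    decTs-encTs (t ∷ ts) = cong₂ _∷_ (decT-encT t) (decTs-encTs ts)

  decF-encF : ∀ {n} (φ : Formula n) → decF (encF φ) ≡ φ
  decF-encF (atom r ts) rewrite uncode-to em relCountable r = cong (atom r) (decTs-encTs ts)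
  decF-encF ⊤ᶠ = refl
  decF-encF ⊥ᶠ = refl
  decF-encF (φ ∧ᶠ ψ) = cong₂ _∧ᶠ_ (decF-encF φ) (decF-encF ψ)
  decF-encF (φ ∨ᶠ ψ) = cong₂ _∨ᶠ_ (decF-encF φ) (decF-encF ψ)
  decF-encF (φ ⇒ ψ) = cong₂ _⇒_ (decF-encF φ) (decF-encF ψ)
  decF-encF (∀ᶠ φ) = cong ∀ᶠ (decF-encF φ)
  decF-encF (∃ᶠ φ) = cong ∃ᶠ (decF-encF φ)

  Sentence↣ℕ : Sentence ↣ ℕ
  Sentence↣ℕ = Code↣ℕ ↣-∘ mk↣ {to = encF} encF-injective
    where
      encF-injective : ∀ {φ ψ : Sentence} → encF φ ≡ encF ψ → φ ≡ ψ
      encF-injective {φ} {ψ} e = begin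
        φ               ≡⟨ decF-encF φ ⟨
        decF (encF φ)   ≡⟨ cong decF e ⟩
        decF (encF ψ)   ≡⟨ decF-encF ψ ⟩
        ψ               ∎
        where open ≡-Reasoning

  code : Sentence → ℕ
  code = Injection.to Sentence↣ℕ

  enumerate : ℕ → Sentence
  enumerate n = fromMaybe ⊤ᶠ (uncode em Sentence↣ℕ n)

  enumerate-code : ∀ φ → enumerate (code φ) ≡ φ
  enumerate-code φ = cong (fromMaybe ⊤ᶠ) (uncode-to em Sentence↣ℕ φ)

module BasicCalculus (em : ExcludedMiddle 0ℓ) (L : Signature) where
  open Logic L
  open Substitution L

  reparam : ∀ {P Q O φ} → Der P basic O φ → Der Q basic O φ
  reparam hyp = hyp
  reparam ⊤I = ⊤I
  reparam (⊥E d) = ⊥E (reparam d)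
  reparam (∧I d e) = ∧I (reparam d) (reparam e)
  reparam (∧E₁ d) = ∧E₁ (reparam d)
  reparam (∧E₂ d) = ∧E₂ (reparam d)
  reparam (∨I₁ d) = ∨I₁ (reparam d)
  reparam (∨I₂ d) = ∨I₂ (reparam d)
  reparam (∨E d d₁ δ₁ d₂ δ₂) = ∨E (reparam d) (reparam d₁) δ₁ (reparam d₂) δ₂
  reparam (⇒I d δ) = ⇒I (reparam d) δ
  reparam (iTrans d e) = iTrans (reparam d) (reparam e)
  reparam (i∧I d e) = i∧I (reparam d) (reparam e)
  reparam (i∨E d e) = i∨E (reparam d) (reparam e)
  reparam (i∀I d) = i∀I (reparam d)
  reparam (i∃E d) = i∃E (reparam d)
  reparam (∀I d nα fr) = ∀I (reparam d) nα fr
  reparam (∀E t d) = ∀E t (reparam d)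
  reparam (CD d) = CD (reparam d)
  reparam (∃I t d) = ∃I t (reparam d)
  reparam (∃E d d₁ δ nα nψ fr) = ∃E (reparam d) (reparam d₁) δ nα nψ fr

  ⋀ : List Sentence → Sentence
  ⋀ [] = ⊤ᶠ
  ⋀ (φ ∷ Φ) = φ ∧ᶠ ⋀ Φ

  module _ {P : Sentence → Set} where
    private
      B : List Occ → Sentence → Set
      B O φ = Der P basic O φ

    keepAll : ∀ {φ} (O : List Occ) → Discharge φ O O
    keepAll [] = []
    keepAll (o ∷ O) = keep (keepAll O)

    implies : ∀ {φ ψ} → B ((φ , safe) ∷ []) ψ → B [] (φ ⇒ ψ)
    implies d = ⇒I d (drop [])

    idT : ∀ φ → B [] (φ ⇒ φ)
    idT φ = implies hyp

    post : ∀ {U φ ψ χ} → B U (φ ⇒ ψ) → B [] (ψ ⇒ χ) → B U (φ ⇒ χ)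
    post {U} d t = subst (λ O → B O _) (++-identityʳ U) (iTrans d t)

    pairT : ∀ {U φ ψ χ} → B U (χ ⇒ φ) → B [] (χ ⇒ ψ) → B U (χ ⇒ φ ∧ᶠ ψ)
    pairT {U} d t = subst (λ O → B O _) (++-identityʳ U) (i∧I d t)

    projT : ∀ {φ Φ} → φ ∈ Φ → B [] (⋀ Φ ⇒ φ)
    projT (here refl) = implies (∧E₁ hyp)
    projT (there p) = iTrans (implies (∧E₂ hyp)) (projT p)

    inclT : ∀ Φ {Ψ} → (∀ {φ} → φ ∈ Φ → φ ∈ Ψ) → B [] (⋀ Ψ ⇒ ⋀ Φ)
    inclT [] h = ⇒I ⊤I []
    inclT (φ ∷ Φ) h = i∧I (projT (h (here refl))) (inclT Φ (λ p → h (there p)))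

    distT : ∀ χ φ ψ → B [] (χ ∧ᶠ (φ ∨ᶠ ψ) ⇒ (φ ∧ᶠ χ) ∨ᶠ (ψ ∧ᶠ χ))
    distT χ φ ψ = ⇒I (∨E (∧E₂ hyp) (∨I₁ (∧I hyp (∧E₁ hyp))) (drop (keep []))
                                   (∨I₂ (∧I hyp (∧E₁ hyp))) (drop (keep [])))
                     (drop (drop (drop [])))

    exportT : ∀ {U φ χ ψ} → B U (φ ∧ᶠ χ ⇒ ψ) → B U (χ ⇒ (φ ⇒ ψ))
    exportT {U} d = ⇒I (iTrans (⇒I (∧I hyp hyp) (drop (keep []))) d) (drop (keepAll U))

    -- ∃v α ∧ γ → ∃v (α ∧ γ), for γ a sentence; the eigen-parameter is chosen
    -- fresh for the antecedent, and the discharges are computed by deciding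
    -- whether the antecedent happens to coincide with the instance.
    ∃-distT : (α : Formula 1) (γ : Sentence) → B [] ((∃ᶠ α ∧ᶠ γ) ⇒ ∃ᶠ (α ∧ᶠ wk γ))
    ∃-distT α γ = derivation antecedentDischarge
      where
        h : Sentence
        h = ∃ᶠ α ∧ᶠ γ
        j : ℕ
        j = freshPar h
        a : Sentence
        a = α [ par j ]
        body : B ((a , safe) ∷ (h , safe) ∷ []) ((α ∧ᶠ wk γ) [ par j ])
        body = subst (λ z → B ((a , safe) ∷ (h , safe) ∷ []) (a ∧ᶠ z)) (sym (wk-inst γ (par j)))
                     (∧I hyp (∧E₂ hyp))
        j∉α : ¬ (j occF α)
        j∉α o = freshPar-fresh h (∧ˡ (∃ᵒ o))
        j∉goal : ¬ (j occF ∃ᶠ (α ∧ᶠ wk γ))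
        j∉goal (∃ᵒ (∧ˡ o)) = j∉α o
        j∉goal (∃ᵒ (∧ʳ o)) = freshPar-fresh h (∧ʳ (occ-wk γ o))
        antecedentDischarge : Σ[ O ∈ List Occ ]
          (DischargeAll a ((h , safe) ∷ []) O × Fresh j O × Discharge h O [])
        antecedentDischarge with em {h ≡ a}
        ... | yes h≡a = [] , subst (λ z → DischargeAll a ((z , safe) ∷ []) []) (sym h≡a) (drop [])
                           , [] , []
        ... | no h≢a = ((h , safe) ∷ []) , keep h≢a [] , (freshPar-fresh h ∷ []) , drop []
        derivation : Σ[ O ∈ List Occ ]
          (DischargeAll a ((h , safe) ∷ []) O × Fresh j O × Discharge h O []) →
          B [] (h ⇒ ∃ᶠ (α ∧ᶠ wk γ))
        derivation (O , δ , fr , δ′) =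
          ⇒I (∃E {i = j} (∧E₁ hyp) (∃I (par j) body) (drop δ) j∉α j∉goal fr) (drop δ′)

-- Eliminating the extra rule: a derivation in NBQL_CD(Σ) of χ becomes a
-- derivation in NBQL_CD of ⋀(its safe assumptions) → χ whose open
-- assumptions are Σ-members that occurred unsafely.  This is where the
-- restrictions on unsafe assumptions are used.
module SafeReduction (em : ExcludedMiddle 0ℓ) (L : Signature) where
  open Logic L
  open Substitution L
  open BasicCalculus em L

  safes : List Occ → List Sentence
  safes [] = []
  safes ((φ , safe) ∷ O) = φ ∷ safes O
  safes ((φ , unsafe) ∷ O) = safes O

  safes-++ : ∀ O₁ O₂ → safes (O₁ ++ O₂) ≡ safes O₁ ++ safes O₂
  safes-++ [] O₂ = refl
  safes-++ ((φ , safe) ∷ O₁) O₂ = cong (φ ∷_) (safes-++ O₁ O₂)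
  safes-++ ((φ , unsafe) ∷ O₁) O₂ = safes-++ O₁ O₂

  safes-markRisky : ∀ O → safes (map markRisky O) ≡ []
  safes-markRisky [] = refl
  safes-markRisky (o ∷ O) = safes-markRisky O

  safes-++⁺ˡ : ∀ O₁ O₂ {φ} → φ ∈ safes O₁ → φ ∈ safes (O₁ ++ O₂)
  safes-++⁺ˡ O₁ O₂ p = subst (_ ∈_) (sym (safes-++ O₁ O₂)) (∈-++⁺ˡ p)

  safes-++⁺ʳ : ∀ O₁ O₂ {φ} → φ ∈ safes O₂ → φ ∈ safes (O₁ ++ O₂)
  safes-++⁺ʳ O₁ O₂ p = subst (_ ∈_) (sym (safes-++ O₁ O₂)) (∈-++⁺ʳ (safes O₁) p)

  safes-occ : ∀ {φ} O → φ ∈ safes O → (φ , safe) ∈ O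
  safes-occ ((ψ , safe) ∷ O) (here refl) = here refl
  safes-occ ((ψ , safe) ∷ O) (there p) = there (safes-occ O p)
  safes-occ ((ψ , unsafe) ∷ O) p = there (safes-occ O p)

  discharge-safes : ∀ {φ O O′ ψ} → Discharge φ O O′ → ψ ∈ safes O → ψ ∈ φ ∷ safes O′
  discharge-safes (keep {o = (χ , safe)} δ) (here refl) = there (here refl)
  discharge-safes (keep {o = (χ , safe)} δ) (there p) with discharge-safes δ p
  ... | here e = here e
  ... | there q = there (there q)
  discharge-safes (keep {o = (χ , unsafe)} δ) p = discharge-safes δ p
  discharge-safes (drop δ) (here refl) = here refl
  discharge-safes (drop δ) (there p) = discharge-safes δ p

  discharge-unsafe : ∀ {φ O O′ ψ} → Discharge φ O O′ → (ψ , unsafe) ∈ O → (ψ , unsafe) ∈ O′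
  discharge-unsafe (keep δ) (here e) = here e
  discharge-unsafe (keep δ) (there p) = there (discharge-unsafe δ p)
  discharge-unsafe (drop δ) (there p) = discharge-unsafe δ p

  dischargeAll-safes : ∀ {φ O O′ ψ} → DischargeAll φ O O′ → ψ ∈ safes O → ψ ∈ φ ∷ safes O′
  dischargeAll-safes (keep {s = safe} _ δ) (here refl) = there (here refl)
  dischargeAll-safes (keep {s = safe} _ δ) (there p) with dischargeAll-safes δ p
  ... | here e = here e
  ... | there q = there (there q)
  dischargeAll-safes (keep {s = unsafe} _ δ) p = dischargeAll-safes δ p
  dischargeAll-safes (drop δ) (here refl) = here refl
  dischargeAll-safes (drop δ) (there p) = dischargeAll-safes δ p

  dischargeAll-unsafe : ∀ {φ O O′ ψ} → DischargeAll φ O O′ → (ψ , unsafe) ∈ O → (ψ , unsafe) ∈ O′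
  dischargeAll-unsafe (keep _ δ) (here e) = here e
  dischargeAll-unsafe (keep _ δ) (there p) = there (dischargeAll-unsafe δ p)
  dischargeAll-unsafe (drop δ) (there p) = dischargeAll-unsafe δ p

  fresh-⋀ : ∀ {i} Φ → (∀ {φ} → φ ∈ Φ → ¬ (i occF φ)) → ¬ (i occF ⋀ Φ)
  fresh-⋀ (φ ∷ Φ) h (∧ˡ o) = h (here refl) o
  fresh-⋀ (φ ∷ Φ) h (∧ʳ o) = fresh-⋀ Φ (λ p → h (there p)) o

  fresh-safes : ∀ {i} O → Fresh i O → ¬ (i occF ⋀ (safes O))
  fresh-safes O fr = fresh-⋀ (safes O) (λ p → All.lookup fr (safes-occ O p))

  Justified : (Sentence → Set) → List Occ → Occ → Set
  Justified S O u = S (proj₁ u) × ((proj₁ u , unsafe) ∈ O)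

  Reduct : (Sentence → Set) → List Occ → Sentence → Set
  Reduct S O χ = Σ[ U ∈ List Occ ] (Der S basic U (⋀ (safes O) ⇒ χ) × All (Justified S O) U)

  justified-mono : ∀ {S O O′} → (∀ {φ} → (φ , unsafe) ∈ O → (φ , unsafe) ∈ O′) →
                   ∀ {U} → All (Justified S O) U → All (Justified S O′) U
  justified-mono f = All.map (λ (s , m) → s , f m)

  reduct-unary : ∀ {S O χ χ′} → (∀ {V} → Der S basic V χ → Der S basic V χ′) →
                 Reduct S O χ → Reduct S O χ′
  reduct-unary rule (U , d , j) = U , post d (implies (rule hyp)) , j

  reduct-binary : ∀ {S O₁ O₂ χ₁ χ₂ χ} → Der S basic [] (χ₁ ∧ᶠ χ₂ ⇒ χ) →
                  Reduct S O₁ χ₁ → Reduct S O₂ χ₂ → Reduct S (O₁ ++ O₂) χ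
  reduct-binary {O₁ = O₁} {O₂} t (U₁ , d₁ , j₁) (U₂ , d₂ , j₂) =
    U₁ ++ U₂ ,
    post (i∧I (iTrans (inclT _ (safes-++⁺ˡ O₁ O₂)) d₁) (iTrans (inclT _ (safes-++⁺ʳ O₁ O₂)) d₂)) t ,
    ++⁺ (justified-mono ∈-++⁺ˡ j₁) (justified-mono (∈-++⁺ʳ O₁) j₂)

  -- The safe conjunction c, paired with φ ∨ ψ, is split by distribution;
  -- each case is handled by the reduct of the corresponding minor premise.
  reduct-∨E : ∀ {S O O₁ O₁′ O₂ O₂′ φ ψ χ} → Discharge φ O₁ O₁′ → Discharge ψ O₂ O₂′ →
              Reduct S O (φ ∨ᶠ ψ) → Reduct S O₁ χ → Reduct S O₂ χ → Reduct S (O ++ O₁′ ++ O₂′) χ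
  reduct-∨E {O = O} {O₁} {O₁′} {O₂} {O₂′} {φ} {ψ} δ₁ δ₂ (U , d , j) (U₁ , d₁ , j₁) (U₂ , d₂ , j₂) =
    U ++ (U₁ ++ U₂) ,
    iTrans (post (i∧I (idT c) (iTrans (inclT _ (safes-++⁺ˡ O W)) d)) (distT c φ ψ))
           (i∨E (iTrans (inclT _ case₁) d₁) (iTrans (inclT _ case₂) d₂)) ,
    ++⁺ (justified-mono ∈-++⁺ˡ j)
        (++⁺ (justified-mono (λ m → ∈-++⁺ʳ O (∈-++⁺ˡ (discharge-unsafe δ₁ m))) j₁)
             (justified-mono (λ m → ∈-++⁺ʳ O (∈-++⁺ʳ O₁′ (discharge-unsafe δ₂ m))) j₂))
    where
      W : List Occ
      W = O₁′ ++ O₂′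
      c : Sentence
      c = ⋀ (safes (O ++ W))
      case₁ : ∀ {χ} → χ ∈ safes O₁ → χ ∈ φ ∷ safes (O ++ W)
      case₁ p with discharge-safes δ₁ p
      ... | here e = here e
      ... | there q = there (safes-++⁺ʳ O W (safes-++⁺ˡ O₁′ O₂′ q))
      case₂ : ∀ {χ} → χ ∈ safes O₂ → χ ∈ ψ ∷ safes (O ++ W)
      case₂ p with discharge-safes δ₂ p
      ... | here e = here e
      ... | there q = there (safes-++⁺ʳ O W (safes-++⁺ʳ O₁′ O₂′ q))

  reduct-⇒I : ∀ {S O O′ φ ψ} → Discharge φ O O′ → Reduct S O ψ → Reduct S O′ (φ ⇒ ψ)
  reduct-⇒I δ (U , d , j) =
    U , exportT (iTrans (inclT _ (discharge-safes δ)) d) , justified-mono (discharge-unsafe δ) j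

  -- The eigen-parameter is fresh for the safe conjunction and, since the
  -- reduced assumptions occur (unsafely) in O, also for them.
  reduct-∀I : ∀ {S O i} {α : Formula 1} → ¬ (i occF α) → Fresh i O →
              Reduct S O (α [ par i ]) → Reduct S O (∀ᶠ α)
  reduct-∀I {O = O} {i} {α} i∉α fr (U , d , j) = U , i∀I (∀I {i = i} d′ i∉ fresh-U) , j
    where
      c : Sentence
      c = ⋀ (safes O)
      d′ : Der _ basic U ((wk c ⇒ α) [ par i ])
      d′ = subst (λ z → Der _ basic U (z ⇒ α [ par i ])) (sym (wk-inst c (par i))) d
      i∉ : ¬ (i occF (wk c ⇒ α))
      i∉ (⇒ˡ o) = fresh-safes O fr (occ-wk c o)
      i∉ (⇒ʳ o) = i∉α o
      fresh-U : Fresh i U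
      fresh-U = All.map (λ (_ , m) → All.lookup fr m) j

  -- The safe conjunction c, paired with ∃α, gives ∃(α ∧ c₁); the minor
  -- premise, generalised on the eigen-parameter, consumes it by Internal
  -- ∃-Elim.
  reduct-∃E : ∀ {S O O₁ O₁′ i} {α : Formula 1} {ψ : Sentence} →
              DischargeAll (α [ par i ]) O₁ O₁′ → ¬ (i occF α) → ¬ (i occF ψ) → Fresh i O₁′ →
              Reduct S O (∃ᶠ α) → Reduct S O₁ ψ → Reduct S (O ++ O₁′) ψ
  reduct-∃E {O = O} {O₁} {O₁′} {i} {α} {ψ} δ i∉α i∉ψ fr (U , d , j) (U₁ , d₁ , j₁) =
    U ++ U₁ ,
    iTrans (post (pairT (iTrans (inclT _ (safes-++⁺ˡ O O₁′)) d) (inclT _ (safes-++⁺ʳ O O₁′)))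
                 (∃-distT α c))
           (i∃E (∀I {i = i} d₁′ i∉ fresh-U₁)) ,
    ++⁺ (justified-mono ∈-++⁺ˡ j) (justified-mono (λ m → ∈-++⁺ʳ O (dischargeAll-unsafe δ m)) j₁)
    where
      c : Sentence
      c = ⋀ (safes O₁′)
      d₁′ : Der _ basic U₁ ((α ∧ᶠ wk c ⇒ wk ψ) [ par i ])
      d₁′ = subst₂ (λ a b → Der _ basic U₁ (α [ par i ] ∧ᶠ a ⇒ b))
                   (sym (wk-inst c (par i))) (sym (wk-inst ψ (par i)))
                   (iTrans (inclT _ (dischargeAll-safes δ)) d₁)
      i∉ : ¬ (i occF (α ∧ᶠ wk c ⇒ wk ψ))
      i∉ (⇒ˡ (∧ˡ o)) = i∉α o
      i∉ (⇒ˡ (∧ʳ o)) = fresh-safes O₁′ fr (occ-wk c o)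
      i∉ (⇒ʳ o) = i∉ψ (occ-wk ψ o)
      fresh-U₁ : Fresh i U₁
      fresh-U₁ = All.map (λ (_ , m) → All.lookup fr (dischargeAll-unsafe δ m)) j₁

  -- The extra rule: its major premise is already a basic derivation from Σ,
  -- and its assumptions become the new unsafe ones.
  reduct-mp : ∀ {S O O′ φ ψ} → Der S basic O′ (φ ⇒ ψ) → All (λ o → S (proj₁ o)) O′ →
              Reduct S O φ → Reduct S (O ++ map markRisky O′) ψ
  reduct-mp {S} {O} {O′} {ψ = ψ} e inS (U , d , j) =
    U ++ O′ ,
    subst (λ Φ → Der S basic (U ++ O′) (⋀ Φ ⇒ ψ)) (sym no-new-safes) (iTrans d e) ,
    ++⁺ (justified-mono ∈-++⁺ˡ j)
        (All.tabulate (λ m → All.lookup inS m , ∈-++⁺ʳ O (∈-map⁺ markRisky m)))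
    where
      no-new-safes : safes (O ++ map markRisky O′) ≡ safes O
      no-new-safes = begin
        safes (O ++ map markRisky O′)          ≡⟨ safes-++ O (map markRisky O′) ⟩
        safes O ++ safes (map markRisky O′)    ≡⟨ cong (safes O ++_) (safes-markRisky O′) ⟩
        safes O ++ []                          ≡⟨ ++-identityʳ (safes O) ⟩
        safes O                                ∎
        where open ≡-Reasoning

  reduce : ∀ {S O χ} → Der S extended O χ → Reduct S O χ
  reduce hyp = [] , projT (here refl) , []
  reduce ⊤I = [] , ⇒I ⊤I [] , []
  reduce (⊥E d) = reduct-unary ⊥E (reduce d)
  reduce (∧I d e) = reduct-binary (⇒I (∧I (∧E₁ hyp) (∧E₂ hyp)) (drop (drop []))) (reduce d) (reduce e)
  reduce (∧E₁ d) = reduct-unary ∧E₁ (reduce d)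
  reduce (∧E₂ d) = reduct-unary ∧E₂ (reduce d)
  reduce (∨I₁ d) = reduct-unary ∨I₁ (reduce d)
  reduce (∨I₂ d) = reduct-unary ∨I₂ (reduce d)
  reduce (∨E d d₁ δ₁ d₂ δ₂) = reduct-∨E δ₁ δ₂ (reduce d) (reduce d₁) (reduce d₂)
  reduce (⇒I d δ) = reduct-⇒I δ (reduce d)
  reduce (iTrans d e) =
    reduct-binary (⇒I (iTrans (∧E₁ hyp) (∧E₂ hyp)) (drop (drop []))) (reduce d) (reduce e)
  reduce (i∧I d e) = reduct-binary (⇒I (i∧I (∧E₁ hyp) (∧E₂ hyp)) (drop (drop []))) (reduce d) (reduce e)
  reduce (i∨E d e) = reduct-binary (⇒I (i∨E (∧E₁ hyp) (∧E₂ hyp)) (drop (drop []))) (reduce d) (reduce e)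
  reduce (i∀I d) = reduct-unary i∀I (reduce d)
  reduce (i∃E d) = reduct-unary i∃E (reduce d)
  reduce (∀I d i∉α fr) = reduct-∀I i∉α fr (reduce d)
  reduce (∀E t d) = reduct-unary (∀E t) (reduce d)
  reduce (CD d) = reduct-unary CD (reduce d)
  reduce (∃I t d) = reduct-unary (∃I t) (reduce d)
  reduce (∃E d d₁ δ i∉α i∉ψ fr) = reduct-∃E δ i∉α i∉ψ fr (reduce d) (reduce d₁)
  reduce (mp d e inS) = reduct-mp e inS (reduce d)

  conjoin : ∀ {S} Φ Ψ → (∀ {ψ} → ψ ∈ Ψ → S ψ ⊎ ψ ∈ Φ) →
            Σ[ V ∈ List Occ ] (Der S basic V (⋀ Φ ⇒ ⋀ Ψ) × All (λ o → S (proj₁ o)) V)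
  conjoin Φ [] h = [] , ⇒I ⊤I [] , []
  conjoin Φ (ψ ∷ Ψ) h with h (here refl) | conjoin Φ Ψ (λ m → h (there m))
  ... | inj₁ s | V , d , a = (ψ , safe) ∷ V , i∧I (⇒I hyp (keep [])) d , s ∷ a
  ... | inj₂ m | V , d , a = V , i∧I (projT m) d , a

  reduce-to : ∀ {S O χ} Φ → All (λ o → S (proj₁ o) ⊎ proj₁ o ∈ Φ) O → Der S extended O χ →
              Σ[ V ∈ List Occ ] (Der S basic V (⋀ Φ ⇒ χ) × All (λ o → S (proj₁ o)) V)
  reduce-to {O = O} Φ from d with reduce d | conjoin Φ (safes O) (λ m → All.lookup from (safes-occ O m))
  ... | U , d′ , j | V , c , a = V ++ U , iTrans c d′ , ++⁺ a (All.map proj₁ j)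

counterexample : ExcludedMiddle 0ℓ → {A : Set} {P : A → Set} → ¬ (∀ a → P a) → Σ[ a ∈ A ] ¬ P a
counterexample em {A} {P} ¬∀ with em {Σ[ a ∈ A ] ¬ P a}
... | yes ex = ex
... | no ∄ = ⊥-elim (¬∀ (λ a → em⇒dne em (λ ¬Pa → ∄ (a , ¬Pa))))

module Lindenbaum (em : ExcludedMiddle 0ℓ) (L : Signature) where
  open Logic L
  open Substitution L
  open Enumeration em L
  open BasicCalculus em L
  open SafeReduction em L

  module Construction (S : Sentence → Set) (Γ : List Sentence) (φ : Sentence)
                      (satS : Sat S) (Γ⊬φ : ¬ ((S ∪ˡ Γ) ⊢[ S ] φ)) where

    S-closed : ∀ {P O χ} → Der P basic O χ → All (λ o → S (proj₁ o)) O → S χ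
    S-closed d a = IsPrimeSat.closed satS _ (_ , reparam d , a)

    S-theorem : ∀ {P χ} → Der P basic [] χ → S χ
    S-theorem d = S-closed d []

    S-const : ∀ {χ} γ → S χ → S (γ ⇒ χ)
    S-const {χ} γ s = S-closed {P = S} (⇒I (hyp {φ = χ}) (keep [])) (s ∷ [])

    S-pre : ∀ {P χ₁ χ₂ χ₃} → Der P basic [] (χ₁ ⇒ χ₂) → S (χ₂ ⇒ χ₃) → S (χ₁ ⇒ χ₃)
    S-pre t s = S-closed (iTrans t hyp) (s ∷ [])

    S-post : ∀ {P χ₁ χ₂ χ₃} → S (χ₁ ⇒ χ₂) → Der P basic [] (χ₂ ⇒ χ₃) → S (χ₁ ⇒ χ₃)
    S-post s t = S-closed (iTrans hyp t) (s ∷ [])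

    ⋁ : List Sentence → Sentence
    ⋁ [] = φ
    ⋁ (ψ ∷ R) = ψ ∨ᶠ ⋁ R

    ⋁-member : ∀ {P ψ R} → ψ ∈ R → Der P basic [] (ψ ⇒ ⋁ R)
    ⋁-member (here refl) = implies (∨I₁ hyp)
    ⋁-member (there p) = iTrans (⋁-member p) (implies (∨I₂ hyp))

    ⋁-φ : ∀ {P} R → Der P basic [] (φ ⇒ ⋁ R)
    ⋁-φ [] = idT φ
    ⋁-φ (ψ ∷ R) = iTrans (⋁-φ R) (implies (∨I₂ hyp))

    ⋁-mono : ∀ {P} R {R′} → (∀ {ψ} → ψ ∈ R → ψ ∈ R′) → Der P basic [] (⋁ R ⇒ ⋁ R′)
    ⋁-mono [] h = ⋁-φ _
    ⋁-mono (ψ ∷ R) h = i∨E (⋁-member (h (here refl))) (⋁-mono R (λ p → h (there p)))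

    Unrefuted : List Sentence → List Sentence → Set
    Unrefuted F R = ¬ S (⋀ F ⇒ ⋁ R)

    record Stage : Set where
      constructor stageOf
      field
        F R : List Sentence
        unrefuted : Unrefuted F R
    open Stage

    rejectable : ∀ ψ F R → S (⋀ (ψ ∷ F) ⇒ ⋁ R) → Unrefuted F R → Unrefuted F (ψ ∷ R)
    rejectable ψ F R accepting-refuted u rejecting-refuted = u (S-closed {P = S}
      (iTrans (i∧I (idT (⋀ F)) hyp)
              (iTrans (distT (⋀ F) ψ (⋁ R)) (i∨E hyp (implies (∧E₁ hyp)))))
      (rejecting-refuted ∷ accepting-refuted ∷ []))

    -- The ω-rule of Σ: if every instance is refuted, so is the quantified case.
    ∃-refuted : ∀ α F χ → (∀ t → S (⋀ (α [ t ] ∷ ∃ᶠ α ∷ F) ⇒ χ)) → S (⋀ (∃ᶠ α ∷ F) ⇒ χ)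
    ∃-refuted α F χ all = S-closed {P = S}
      (iTrans (i∧I (projT (here refl)) (idT γ)) (iTrans (∃-distT α γ) (i∃E hyp))) (instances ∷ [])
      where
        γ : Sentence
        γ = ⋀ (∃ᶠ α ∷ F)
        instances : S (∀ᶠ (α ∧ᶠ wk γ ⇒ wk χ))
        instances = IsPrimeSat.omega satS _ (λ t →
          subst₂ (λ a b → S (α [ t ] ∧ᶠ a ⇒ b)) (sym (wk-inst γ t)) (sym (wk-inst χ t)) (all t))

    ∀-refuted : ∀ α F R → (∀ t → S (⋀ F ⇒ ⋁ (α [ t ] ∷ ∀ᶠ α ∷ R))) → S (⋀ F ⇒ ⋁ (∀ᶠ α ∷ R))
    ∀-refuted α F R all = S-closed {P = S}
      (iTrans (iTrans (i∀I hyp) (implies (CD hyp))) (i∨E (idT Y) (implies (∨I₁ hyp)))) (instances ∷ [])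
      where
        γ Y : Sentence
        γ = ⋀ F
        Y = ⋁ (∀ᶠ α ∷ R)
        swapT : ∀ a b → Der S basic [] (a ∨ᶠ b ⇒ b ∨ᶠ a)
        swapT a b = implies (∨E hyp (∨I₂ hyp) (drop []) (∨I₁ hyp) (drop []))
        instances : S (∀ᶠ (wk γ ⇒ wk Y ∨ᶠ α))
        instances = IsPrimeSat.omega satS _ (λ t →
          subst₂ (λ a b → S (a ⇒ b ∨ᶠ α [ t ])) (sym (wk-inst γ t)) (sym (wk-inst Y t))
                 (S-post (all t) (swapT (α [ t ]) Y)))

    ∃-witness : ∀ α F R → Unrefuted (∃ᶠ α ∷ F) R → Σ[ t ∈ ClosedTerm ] Unrefuted (α [ t ] ∷ ∃ᶠ α ∷ F) R
    ∃-witness α F R u = counterexample em (λ all → u (∃-refuted α F (⋁ R) all))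

    ∀-witness : ∀ α F R → Unrefuted F (∀ᶠ α ∷ R) → Σ[ t ∈ ClosedTerm ] Unrefuted F (α [ t ] ∷ ∀ᶠ α ∷ R)
    ∀-witness α F R u = counterexample em (λ all → u (∀-refuted α F R all))

    acceptWitnesses : ∀ ψ F R → Unrefuted (ψ ∷ F) R → Σ[ E ∈ List Sentence ] Unrefuted (E ++ ψ ∷ F) R
    acceptWitnesses (∃ᶠ α) F R u = (α [ proj₁ w ] ∷ []) , proj₂ w
      where
        w : Σ[ t ∈ ClosedTerm ] Unrefuted (α [ t ] ∷ ∃ᶠ α ∷ F) R
        w = ∃-witness α F R u
    acceptWitnesses ψ F R u = [] , u

    rejectWitnesses : ∀ ψ F R → Unrefuted F (ψ ∷ R) → Σ[ E ∈ List Sentence ] Unrefuted F (E ++ ψ ∷ R)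
    rejectWitnesses (∀ᶠ α) F R u = (α [ proj₁ w ] ∷ []) , proj₂ w
      where
        w : Σ[ t ∈ ClosedTerm ] Unrefuted F (α [ t ] ∷ ∀ᶠ α ∷ R)
        w = ∀-witness α F R u
    rejectWitnesses ψ F R u = [] , u

    extend : ∀ ψ st → Dec (S (⋀ (ψ ∷ F st) ⇒ ⋁ (R st))) → Stage
    extend ψ (stageOf F R u) (no u′) =
      stageOf (proj₁ (acceptWitnesses ψ F R u′) ++ ψ ∷ F) R (proj₂ (acceptWitnesses ψ F R u′))
    extend ψ (stageOf F R u) (yes r) =
      stageOf F (proj₁ (rejectWitnesses ψ F R u′) ++ ψ ∷ R) (proj₂ (rejectWitnesses ψ F R u′))
      where
        u′ : Unrefuted F (ψ ∷ R)
        u′ = rejectable ψ F R r u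

    extend-F : ∀ ψ st d {χ} → χ ∈ F st → χ ∈ F (extend ψ st d)
    extend-F ψ (stageOf F R u) (no u′) m = ∈-++⁺ʳ (proj₁ (acceptWitnesses ψ F R u′)) (there m)
    extend-F ψ (stageOf F R u) (yes r) m = m

    extend-R : ∀ ψ st d {χ} → χ ∈ R st → χ ∈ R (extend ψ st d)
    extend-R ψ (stageOf F R u) (no u′) m = m
    extend-R ψ (stageOf F R u) (yes r) m =
      ∈-++⁺ʳ (proj₁ (rejectWitnesses ψ F R (rejectable ψ F R r u))) (there m)

    extend-decides : ∀ ψ st d → ψ ∈ F (extend ψ st d) ⊎ ψ ∈ R (extend ψ st d)
    extend-decides ψ (stageOf F R u) (no u′) =
      inj₁ (∈-++⁺ʳ (proj₁ (acceptWitnesses ψ F R u′)) (here refl))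
    extend-decides ψ (stageOf F R u) (yes r) =
      inj₂ (∈-++⁺ʳ (proj₁ (rejectWitnesses ψ F R (rejectable ψ F R r u))) (here refl))

    extend-∃ : ∀ α st d → ∃ᶠ α ∈ R (extend (∃ᶠ α) st d) ⊎
                            Σ[ t ∈ ClosedTerm ] α [ t ] ∈ F (extend (∃ᶠ α) st d)
    extend-∃ α (stageOf F R u) (no u′) = inj₂ (proj₁ (∃-witness α F R u′) , here refl)
    extend-∃ α (stageOf F R u) (yes r) =
      inj₁ (∈-++⁺ʳ (proj₁ (rejectWitnesses (∃ᶠ α) F R (rejectable (∃ᶠ α) F R r u))) (here refl))

    extend-∀ : ∀ α st d → ∀ᶠ α ∈ F (extend (∀ᶠ α) st d) ⊎
                            Σ[ t ∈ ClosedTerm ] α [ t ] ∈ R (extend (∀ᶠ α) st d)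
    extend-∀ α (stageOf F R u) (no u′) =
      inj₁ (∈-++⁺ʳ (proj₁ (acceptWitnesses (∀ᶠ α) F R u′)) (here refl))
    extend-∀ α (stageOf F R u) (yes r) =
      inj₂ (proj₁ (∀-witness α F R (rejectable (∀ᶠ α) F R r u)) , here refl)

    -- The initial stage accepts Γ: by the extra rule, S ⊢ ⋀Γ → φ would give
    -- Σ ∪ Γ ⊢_Σ φ.
    initial : Unrefuted Γ []
    initial s = Γ⊬φ (_ , mp (conjunction Γ) hyp (s ∷ []) , ++⁺ (map⁺ (All.tabulate inj₂)) (inj₁ s ∷ []))
      where
        conjunction : ∀ Δ → Der S extended (map (_, safe) Δ) (⋀ Δ)
        conjunction [] = ⊤I
        conjunction (δ ∷ Δ) = ∧I hyp (conjunction Δ)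

    stage : ℕ → Stage
    stage zero = stageOf Γ [] initial
    stage (suc n) = extend (enumerate n) (stage n) em

    Fₙ Rₙ : ℕ → List Sentence
    Fₙ n = F (stage n)
    Rₙ n = R (stage n)

    F-mono : ∀ {m n} → m ≤ n → ∀ {χ} → χ ∈ Fₙ m → χ ∈ Fₙ n
    F-mono m≤n = go (≤⇒≤′ m≤n)
      where
        go : ∀ {m n} → m ≤′ n → ∀ {χ} → χ ∈ Fₙ m → χ ∈ Fₙ n
        go ≤′-refl p = p
        go (≤′-step {n} le) p = extend-F (enumerate n) (stage n) em (go le p)

    R-mono : ∀ {m n} → m ≤ n → ∀ {χ} → χ ∈ Rₙ m → χ ∈ Rₙ n
    R-mono m≤n = go (≤⇒≤′ m≤n)
      where
        go : ∀ {m n} → m ≤′ n → ∀ {χ} → χ ∈ Rₙ m → χ ∈ Rₙ n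
        go ≤′-refl p = p
        go (≤′-step {n} le) p = extend-R (enumerate n) (stage n) em (go le p)

    decidedAt : Sentence → ℕ
    decidedAt ψ = suc (code ψ)

    stage-decidedAt : ∀ ψ → stage (decidedAt ψ) ≡ extend ψ (stage (code ψ)) em
    stage-decidedAt ψ = cong (λ χ → extend χ (stage (code ψ)) em) (enumerate-code ψ)

    decided : ∀ ψ → ψ ∈ Fₙ (decidedAt ψ) ⊎ ψ ∈ Rₙ (decidedAt ψ)
    decided ψ = subst (λ st → ψ ∈ F st ⊎ ψ ∈ R st) (sym (stage-decidedAt ψ))
                      (extend-decides ψ (stage (code ψ)) em)

    ∃-decided : ∀ α → ∃ᶠ α ∈ Rₙ (decidedAt (∃ᶠ α)) ⊎ Σ[ t ∈ ClosedTerm ] α [ t ] ∈ Fₙ (decidedAt (∃ᶠ α))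
    ∃-decided α = subst (λ st → ∃ᶠ α ∈ R st ⊎ Σ[ t ∈ ClosedTerm ] α [ t ] ∈ F st)
                        (sym (stage-decidedAt (∃ᶠ α))) (extend-∃ α (stage (code (∃ᶠ α))) em)

    ∀-decided : ∀ α → ∀ᶠ α ∈ Fₙ (decidedAt (∀ᶠ α)) ⊎ Σ[ t ∈ ClosedTerm ] α [ t ] ∈ Rₙ (decidedAt (∀ᶠ α))
    ∀-decided α = subst (λ st → ∀ᶠ α ∈ F st ⊎ Σ[ t ∈ ClosedTerm ] α [ t ] ∈ R st)
                        (sym (stage-decidedAt (∀ᶠ α))) (extend-∀ α (stage (code (∀ᶠ α))) em)

    incompatible : ∀ n k {χ} → S (⋀ (Fₙ n) ⇒ χ) → Der S basic [] (χ ⇒ ⋁ (Rₙ k)) → ⊥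
    incompatible n k s t = unrefuted (stage (n ⊔ k))
      (S-post (S-pre {P = S} (inclT _ (F-mono (m≤m⊔n n k))) s)
              (iTrans t (⋁-mono _ (R-mono (m≤n⊔m n k)))))

    Θ : Sentence → Set
    Θ χ = S χ ⊎ Σ[ n ∈ ℕ ] χ ∈ Fₙ n

    Θ-contains : ∀ ψ → (S ∪ˡ Γ) ψ → Θ ψ
    Θ-contains ψ (inj₁ s) = inj₁ s
    Θ-contains ψ (inj₂ m) = inj₂ (0 , m)

    Θ-finite : ∀ {χ} → Θ χ → Σ[ n ∈ ℕ ] S (⋀ (Fₙ n) ⇒ χ)
    Θ-finite (inj₁ s) = 0 , S-const _ s
    Θ-finite (inj₂ (n , m)) = n , S-theorem {P = S} (projT m)

    -- Conversely, whatever some stage implies over Σ is accepted, since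
    -- rejecting it would break the invariant.
    Θ-from-stage : ∀ n {χ} → S (⋀ (Fₙ n) ⇒ χ) → Θ χ
    Θ-from-stage n {χ} s with decided χ
    ... | inj₁ m = inj₂ (decidedAt χ , m)
    ... | inj₂ m = ⊥-elim (incompatible n (decidedAt χ) s (⋁-member m))

    Θ-excluded : ∀ {χ} k → Θ χ → Der S basic [] (χ ⇒ ⋁ (Rₙ k)) → ⊥
    Θ-excluded k θ t with Θ-finite θ
    ... | n , s = incompatible n k s t

    Θ-rejected : ∀ {χ} k → Θ χ → χ ∈ Rₙ k → ⊥
    Θ-rejected k θ m = Θ-excluded k θ (⋁-member m)

    φ∉Θ : ¬ Θ φ
    φ∉Θ θ = Θ-excluded 0 θ (⋁-φ [])

    Θ-consistent : ¬ Θ ⊥ᶠ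
    Θ-consistent θ with Θ-finite θ
    ... | n , s = φ∉Θ (Θ-from-stage n (S-post {P = S} s (implies (⊥E hyp))))

    Θ-bound : ∀ {O : List Occ} → All (λ o → Θ (proj₁ o)) O →
              Σ[ n ∈ ℕ ] All (λ o → S (proj₁ o) ⊎ proj₁ o ∈ Fₙ n) O
    Θ-bound [] = 0 , []
    Θ-bound (inj₁ s ∷ a) with Θ-bound a
    ... | n , b = n , inj₁ s ∷ b
    Θ-bound (inj₂ (m , p) ∷ a) with Θ-bound a
    ... | n , b = m ⊔ n , inj₂ (F-mono (m≤m⊔n m n) p) ∷ All.map (Sum.map₂ (F-mono (m≤n⊔m m n))) b

    Θ-closed : ∀ χ → Θ ⊢[ S ] χ → Θ χ
    Θ-closed χ (O , d , a) with Θ-bound a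
    ... | n , b with reduce-to (Fₙ n) b d
    ... | V , d′ , inS = Θ-from-stage n (S-closed d′ inS)

    Θ-prime : ∀ χ₁ χ₂ → Θ (χ₁ ∨ᶠ χ₂) → Θ χ₁ ⊎ Θ χ₂
    Θ-prime χ₁ χ₂ θ = from (decided χ₁) (decided χ₂)
      where
        k₁ k₂ : ℕ
        k₁ = decidedAt χ₁
        k₂ = decidedAt χ₂
        from : χ₁ ∈ Fₙ k₁ ⊎ χ₁ ∈ Rₙ k₁ → χ₂ ∈ Fₙ k₂ ⊎ χ₂ ∈ Rₙ k₂ → Θ χ₁ ⊎ Θ χ₂
        from (inj₁ m₁) _ = inj₁ (inj₂ (k₁ , m₁))
        from (inj₂ _) (inj₁ m₂) = inj₂ (inj₂ (k₂ , m₂))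
        from (inj₂ m₁) (inj₂ m₂) = ⊥-elim (Θ-excluded (k₁ ⊔ k₂) θ
          (i∨E (⋁-member (R-mono (m≤m⊔n k₁ k₂) m₁)) (⋁-member (R-mono (m≤n⊔m k₁ k₂) m₂))))

    Θ-witness : ∀ α → Θ (∃ᶠ α) → Σ[ t ∈ ClosedTerm ] Θ (α [ t ])
    Θ-witness α θ = from (∃-decided α)
      where
        k : ℕ
        k = decidedAt (∃ᶠ α)
        from : ∃ᶠ α ∈ Rₙ k ⊎ Σ[ t ∈ ClosedTerm ] α [ t ] ∈ Fₙ k → Σ[ t ∈ ClosedTerm ] Θ (α [ t ])
        from (inj₁ m) = ⊥-elim (Θ-rejected k θ m)
        from (inj₂ (t , m)) = t , inj₂ (k , m)

    Θ-omega : ∀ α → (∀ t → Θ (α [ t ])) → Θ (∀ᶠ α)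
    Θ-omega α θ = from (∀-decided α)
      where
        k : ℕ
        k = decidedAt (∀ᶠ α)
        from : ∀ᶠ α ∈ Fₙ k ⊎ Σ[ t ∈ ClosedTerm ] α [ t ] ∈ Rₙ k → Θ (∀ᶠ α)
        from (inj₁ m) = inj₂ (k , m)
        from (inj₂ (t , m)) = ⊥-elim (Θ-rejected k (θ t) m)

    Θ-saturated : SatΣ S Θ
    Θ-saturated = record
      { consistent = Θ-consistent
      ; closed     = Θ-closed
      ; prime      = Θ-prime
      ; witness    = Θ-witness
      ; omega      = Θ-omega
      }

mainTheorem12 : ExcludedMiddle 0ℓ → (L : Signature) →
    let open Logic L in
    (S : Sentence → Set) (Γ : List Sentence) (φ : Sentence) →
    Sat S → ¬ ((S ∪ˡ Γ) ⊢[ S ] φ) →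
    Σ[ Θ ∈ (Sentence → Set) ] ((∀ ψ → (S ∪ˡ Γ) ψ → Θ ψ) × SatΣ S Θ × ¬ Θ φ)
mainTheorem12 em L S Γ φ satS Γ⊬φ = Θ , Θ-contains , Θ-saturated , φ∉Θ
  where open Lindenbaum.Construction em L S Γ φ satS Γ⊬φ
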